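{- Let $n$ be a positive integer. Then the polynomial $$ \frac{1}{n^2}\sum_{k=0}^{n-1}(2k+1)\sum_{j=0}^{k}{ -x-1\choose j}^2{x\choose k-j}^2 $$ in $\mathbb{Q}[x]$ is integer-valued, i.e., it takes an integer value at every $x\in\mathbb{Z}$.
   Context: For a variable $x$ and a non-negative integer $k$, ${x\choose k}$ denotes the polynomial $x(x-1)\cdots(x-k+1)/k!$ (equal to $1$ for $k=0$), and ${ -x-1\choose k}$ is this polynomial evaluated at $-x-1$. A polynomial $P(x)\in\mathbb{Q}[x]$ is called integer-valued if $P(x)\in\mathbb{Z}$ for all $x\in\mathbb{Z}$. -}

module Defs where

open import Data.Nat as ℕ using (ℕ; zero; suc; _!)
open import Data.Nat.Properties using (_!≢0; m*n≢0)
open import Data.Integer as ℤ using (ℤ)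
open import Data.Rational using (ℚ; _+_; _*_; _-_; -_; _/_; 0ℚ; 1ℚ)

ℕ→ℚ : ℕ → ℚ
ℕ→ℚ n = ℤ.+ n / 1

ℤ→ℚ : ℤ → ℚ
ℤ→ℚ z = z / 1

fall : ℚ → ℕ → ℚ
fall x zero    = 1ℚ
fall x (suc k) = fall x k * (x - ℕ→ℚ k)

binom : ℚ → ℕ → ℚ
binom x k = fall x k * (ℤ.+ 1 / (k !)) {{k !≢0}}

sumUpTo : ℕ → (ℕ → ℚ) → ℚ
sumUpTo zero    f = f zero
sumUpTo (suc m) f = sumUpTo m f + f (suc m)

sumBelow : ℕ → (ℕ → ℚ) → ℚ
sumBelow zero    f = 0ℚ
sumBelow (suc m) f = sumBelow m f + f m

sq : ℚ → ℚ
sq q = q * q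

P : (n : ℕ) → .{{ℕ.NonZero n}} → ℚ → ℚ
P n x = (ℤ.+ 1 / (n ℕ.* n)) {{m*n≢0 n n}} *
        sumBelow n (λ k → ℕ→ℚ (2 ℕ.* k ℕ.+ 1) *
          sumUpTo k (λ j → sq (binom (- x - 1ℚ) j) * sq (binom x (k ℕ.∸ j))))

-- Reflection C(-x-1,j)² = C(x+j,j)² and trinomial revision turn the inner sum into
-- u_k = Σⱼ C(k,j)² C(x+j,k)².  By creative telescoping (explicit certificates), u_k and
-- v_k = Σⱼ C(k,j) C(k+j,j) C(x,j) C(x+j,j) satisfy the same recurrence
-- (k+1)³ w_k − (2k+3)(k²+3k+3+2x(x+1)) w_{k+1} + (k+2)³ w_{k+2} = 0 with equal initial
-- values, so u = v.  A second telescoping, now in k, gives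
-- Σ_{k<n} (2k+1) v_k = n² Σ_{j<n} C(n-1,j) C(n+j,j) C(x,j) C(x+j,j)/(j+1), and
-- C(x,j) C(x+j,j)/(j+1) = (C(2j,j) − C(2j,j+1)) C(x+j,2j) is integer-valued.

module Submission where

open import Defs
open import Agda.Builtin.FromNat using (Number; fromNat)
open import Data.Nat as ℕ using (ℕ; zero; suc; NonZero; _!; _<_; s≤s)
import Data.Nat.Properties as ℕP
open import Data.Nat.Properties using (_!≢0)
open import Data.Integer as ℤ using (ℤ; -[1+_])
import Data.Integer.Properties as ℤP
open import Data.Rational as ℚ using (ℚ; _+_; _*_; _-_; -_; _/_; 0ℚ; 1ℚ; toℚᵘ)
import Data.Nat.Literals as ℕLit
import Data.Rational.Literals as ℚLit
import Data.Rational.Properties as ℚP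
open import Data.Rational.Unnormalised as ℚᵘ using (mkℚᵘ; *≡*)
import Data.Rational.Unnormalised.Properties as ℚᵘP
open import Data.Unit.Base using (tt)
open import Data.List.Base using ([]; _∷_)
open import Data.Product using (∃; _,_; _×_; proj₁; proj₂)
open import Data.Sum using (inj₁; inj₂)
open import Level using (0ℓ)
open import Algebra.Bundles using (CommutativeMonoid)
open import Algebra.Properties.CommutativeSemigroup (CommutativeMonoid.commutativeSemigroup ℚP.*-1-commutativeMonoid)
  using (interchange; xy∙z≈xz∙y; xy∙z≈x∙zy)
open import Relation.Binary.PropositionalEquality
open import Relation.Nullary.Decidable using (dec⇒maybe)
open import Tactic.RingSolver using (solve-∀; solve)
open import Tactic.RingSolver.Core.AlmostCommutativeRing using (AlmostCommutativeRing; fromCommutativeRing)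

instance
  ℕ-number : Number ℕ
  ℕ-number = ℕLit.number

  ℚ-number : Number ℚ
  ℚ-number = ℚLit.number

ℚ-ring : AlmostCommutativeRing 0ℓ 0ℓ
ℚ-ring = fromCommutativeRing ℚP.+-*-commutativeRing (λ q → dec⇒maybe (0ℚ ℚP.≟ q))

*-cancelʳ-≡ : ∀ {p q} r → r ≢ 0ℚ → p * r ≡ q * r → p ≡ q
*-cancelʳ-≡ {p} {q} r r≢0 pr≡qr = begin
  p                ≡⟨ cancel p ⟩
  p * r * ℚ.1/ r   ≡⟨ cong (_* ℚ.1/ r) pr≡qr ⟩
  q * r * ℚ.1/ r   ≡⟨ cancel q ⟨
  q                ∎
  where
  open ≡-Reasoning
  instance
    r-nonZero : ℚ.NonZero r
    r-nonZero = ℚ.≢-nonZero r≢0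
  cancel : ∀ s → s ≡ s * r * ℚ.1/ r
  cancel s = sym (trans (ℚP.*-assoc s r _) (trans (cong (s *_) (ℚP.*-inverseʳ r)) (ℚP.*-identityʳ s)))

toℚᵘ-ℤ→ℚ : ∀ z → toℚᵘ (ℤ→ℚ z) ℚᵘ.≃ mkℚᵘ z 0
toℚᵘ-ℤ→ℚ z = ℚP.toℚᵘ-fromℚᵘ (mkℚᵘ z 0)

ℤ→ℚ-+ : ∀ a b → ℤ→ℚ (a ℤ.+ b) ≡ ℤ→ℚ a + ℤ→ℚ b
ℤ→ℚ-+ a b = ℚP.toℚᵘ-injective (begin
  toℚᵘ (ℤ→ℚ (a ℤ.+ b))            ≈⟨ toℚᵘ-ℤ→ℚ (a ℤ.+ b) ⟩
  mkℚᵘ (a ℤ.+ b) 0                ≈⟨ *≡* (cong (ℤ._* ℤ.+ 1) (sym (cong₂ ℤ._+_ (ℤP.*-identityʳ a) (ℤP.*-identityʳ b)))) ⟩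
  mkℚᵘ a 0 ℚᵘ.+ mkℚᵘ b 0          ≈⟨ ℚᵘP.+-cong (toℚᵘ-ℤ→ℚ a) (toℚᵘ-ℤ→ℚ b) ⟨
  toℚᵘ (ℤ→ℚ a) ℚᵘ.+ toℚᵘ (ℤ→ℚ b)  ≈⟨ ℚP.toℚᵘ-homo-+ (ℤ→ℚ a) (ℤ→ℚ b) ⟨
  toℚᵘ (ℤ→ℚ a + ℤ→ℚ b)            ∎)
  where open ℚᵘP.≃-Reasoning

ℤ→ℚ-* : ∀ a b → ℤ→ℚ (a ℤ.* b) ≡ ℤ→ℚ a * ℤ→ℚ b
ℤ→ℚ-* a b = ℚP.toℚᵘ-injective (begin
  toℚᵘ (ℤ→ℚ (a ℤ.* b))            ≈⟨ toℚᵘ-ℤ→ℚ (a ℤ.* b) ⟩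
  mkℚᵘ a 0 ℚᵘ.* mkℚᵘ b 0          ≈⟨ ℚᵘP.*-cong (toℚᵘ-ℤ→ℚ a) (toℚᵘ-ℤ→ℚ b) ⟨
  toℚᵘ (ℤ→ℚ a) ℚᵘ.* toℚᵘ (ℤ→ℚ b)  ≈⟨ ℚP.toℚᵘ-homo-* (ℤ→ℚ a) (ℤ→ℚ b) ⟨
  toℚᵘ (ℤ→ℚ a * ℤ→ℚ b)            ∎)
  where open ℚᵘP.≃-Reasoning

ℤ→ℚ-neg : ∀ a → ℤ→ℚ (ℤ.- a) ≡ - ℤ→ℚ a
ℤ→ℚ-neg a = ℚP.toℚᵘ-injective (begin
  toℚᵘ (ℤ→ℚ (ℤ.- a))   ≈⟨ toℚᵘ-ℤ→ℚ (ℤ.- a) ⟩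
  ℚᵘ.- mkℚᵘ a 0        ≈⟨ ℚᵘP.-‿cong (toℚᵘ-ℤ→ℚ a) ⟨
  ℚᵘ.- toℚᵘ (ℤ→ℚ a)    ≈⟨ ℚP.toℚᵘ-homo‿- (ℤ→ℚ a) ⟨
  toℚᵘ (- ℤ→ℚ a)       ∎)
  where open ℚᵘP.≃-Reasoning

ℤ→ℚ-injective : ∀ {a b} → ℤ→ℚ a ≡ ℤ→ℚ b → a ≡ b
ℤ→ℚ-injective {a} {b} eq
  with ℚᵘP.≃-trans (ℚᵘP.≃-sym (toℚᵘ-ℤ→ℚ a)) (ℚᵘP.≃-trans (ℚP.toℚᵘ-cong eq) (toℚᵘ-ℤ→ℚ b))
... | *≡* a*1≡b*1 = trans (sym (ℤP.*-identityʳ a)) (trans a*1≡b*1 (ℤP.*-identityʳ b))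

⟦_⟧ : ℕ → ℚ
⟦_⟧ = ℕ→ℚ

⟦+⟧ : ∀ m n → ⟦ m ℕ.+ n ⟧ ≡ ⟦ m ⟧ + ⟦ n ⟧
⟦+⟧ m n = ℤ→ℚ-+ (ℤ.+ m) (ℤ.+ n)

⟦*⟧ : ∀ m n → ⟦ m ℕ.* n ⟧ ≡ ⟦ m ⟧ * ⟦ n ⟧
⟦*⟧ m n = trans (cong ℤ→ℚ (ℤP.pos-* m n)) (ℤ→ℚ-* (ℤ.+ m) (ℤ.+ n))

⟦suc⟧ : ∀ n → ⟦ suc n ⟧ ≡ ⟦ n ⟧ + 1
⟦suc⟧ n = trans (⟦+⟧ 1 n) (ℚP.+-comm 1 ⟦ n ⟧)

⟦2+⟧ : ∀ n → ⟦ suc (suc n) ⟧ ≡ ⟦ n ⟧ + 2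
⟦2+⟧ n = trans (⟦+⟧ 2 n) (ℚP.+-comm 2 ⟦ n ⟧)

+⟦suc⟧ : ∀ y n → y + ⟦ suc n ⟧ ≡ y + ⟦ n ⟧ + 1
+⟦suc⟧ y n = trans (cong (λ t → y + t) (⟦suc⟧ n)) (sym (ℚP.+-assoc y ⟦ n ⟧ 1))

⟦suc⟧≢0 : ∀ n → ⟦ suc n ⟧ ≢ 0ℚ
⟦suc⟧≢0 n eq with ℤ→ℚ-injective {ℤ.+ suc n} {ℤ.+ 0} eq
... | ()

⟦⟧≢0 : ∀ n .{{_ : NonZero n}} → ⟦ n ⟧ ≢ 0ℚ
⟦⟧≢0 (suc n) = ⟦suc⟧≢0 n

recip-inverse : ∀ n .{{_ : NonZero n}} → (ℤ.+ 1 / n) * ⟦ n ⟧ ≡ 1ℚ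
recip-inverse (suc n) = ℚP.toℚᵘ-injective (begin
  toℚᵘ ((ℤ.+ 1 / suc n) * ⟦ suc n ⟧)                ≈⟨ ℚP.toℚᵘ-homo-* (ℤ.+ 1 / suc n) ⟦ suc n ⟧ ⟩
  toℚᵘ (ℤ.+ 1 / suc n) ℚᵘ.* toℚᵘ ⟦ suc n ⟧           ≈⟨ ℚᵘP.*-cong (ℚP.toℚᵘ-fromℚᵘ (mkℚᵘ (ℤ.+ 1) n)) (toℚᵘ-ℤ→ℚ (ℤ.+ suc n)) ⟩
  mkℚᵘ (ℤ.+ 1) n ℚᵘ.* mkℚᵘ (ℤ.+ suc n) 0            ≈⟨ ℚᵘP.*-inverseˡ (mkℚᵘ (ℤ.+ suc n) 0) ⟩
  ℚᵘ.1ℚᵘ                                             ∎)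
  where open ℚᵘP.≃-Reasoning

recip-*ˡ : ∀ a b .{{_ : NonZero a}} .{{_ : NonZero b}} →
           (ℤ.+ 1 / (a ℕ.* b)) {{ℕP.m*n≢0 a b}} * ⟦ a ⟧ ≡ ℤ.+ 1 / b
recip-*ˡ a b = *-cancelʳ-≡ ⟦ b ⟧ (⟦⟧≢0 b) (begin
  r[ab] * ⟦ a ⟧ * ⟦ b ⟧     ≡⟨ ℚP.*-assoc r[ab] ⟦ a ⟧ ⟦ b ⟧ ⟩
  r[ab] * (⟦ a ⟧ * ⟦ b ⟧)   ≡⟨ cong (r[ab] *_) (⟦*⟧ a b) ⟨
  r[ab] * ⟦ a ℕ.* b ⟧       ≡⟨ recip-inverse (a ℕ.* b) {{ℕP.m*n≢0 a b}} ⟩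
  1ℚ                        ≡⟨ recip-inverse b ⟨
  (ℤ.+ 1 / b) * ⟦ b ⟧       ∎)
  where
  open ≡-Reasoning
  r[ab] : ℚ
  r[ab] = (ℤ.+ 1 / (a ℕ.* b)) {{ℕP.m*n≢0 a b}}

-- a ≐ b · r ÷ d  says  a = b r / d, stated without division.

infix 4 _≐_·_÷_

record _≐_·_÷_ (a b r d : ℚ) : Set where
  constructor scaled
  field unscale : a * d ≡ b * r

open _≐_·_÷_ public

scaled-* : ∀ {a b r d a′ b′ r′ d′} → a ≐ b · r ÷ d → a′ ≐ b′ · r′ ÷ d′ → a * a′ ≐ b * b′ · r * r′ ÷ d * d′
scaled-* {a} {b} {r} {d} {a′} {b′} {r′} {d′} (scaled eq) (scaled eq′) = scaled (begin
  (a * a′) * (d * d′)   ≡⟨ interchange a a′ d d′ ⟩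
  (a * d) * (a′ * d′)   ≡⟨ cong₂ _*_ eq eq′ ⟩
  (b * r) * (b′ * r′)   ≡⟨ interchange b r b′ r′ ⟩
  (b * b′) * (r * r′)   ∎)
  where open ≡-Reasoning

scaled-sq : ∀ {a b r d} → a ≐ b · r ÷ d → sq a ≐ sq b · sq r ÷ sq d
scaled-sq s = scaled-* s s

scaled-trans : ∀ {a b c r d r′ d′} → a ≐ b · r ÷ d → b ≐ c · r′ ÷ d′ → a ≐ c · r * r′ ÷ d * d′
scaled-trans {a} {b} {c} {r} {d} {r′} {d′} (scaled eq) (scaled eq′) = scaled (begin
  a * (d * d′)   ≡⟨ ℚP.*-assoc a d d′ ⟨
  a * d * d′     ≡⟨ cong (_* d′) eq ⟩
  b * r * d′     ≡⟨ xy∙z≈xz∙y b r d′ ⟩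
  b * d′ * r     ≡⟨ cong (_* r) eq′ ⟩
  c * r′ * r     ≡⟨ xy∙z≈x∙zy c r′ r ⟩
  c * (r * r′)   ∎)
  where open ≡-Reasoning

scaled-*ˡ : ∀ c {a b r d} → a ≐ b · r ÷ d → c * a ≐ c * b · r ÷ d
scaled-*ˡ c {a} {b} {r} {d} (scaled eq) = scaled (begin
  (c * a) * d   ≡⟨ ℚP.*-assoc c a d ⟩
  c * (a * d)   ≡⟨ cong (c *_) eq ⟩
  c * (b * r)   ≡⟨ ℚP.*-assoc c b r ⟨
  (c * b) * r   ∎)
  where open ≡-Reasoning

scaled-*ʳ : ∀ c {a b r d} → a ≐ b · r ÷ d → a * c ≐ b * c · r ÷ d
scaled-*ʳ c {a} {b} {r} {d} s = subst₂ (λ s t → s ≐ t · r ÷ d) (ℚP.*-comm c a) (ℚP.*-comm c b) (scaled-*ˡ c s)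

scaled-*-exact : ∀ {a b r d a′ b′ r′} → a ≐ b · r ÷ d → a′ ≡ b′ * r′ → a * a′ ≐ b * b′ · r * r′ ÷ d
scaled-*-exact {a} {b} {r} {d} {a′} {b′} {r′} (scaled eq) eq′ = scaled (begin
  (a * a′) * d          ≡⟨ xy∙z≈xz∙y a a′ d ⟩
  (a * d) * a′          ≡⟨ cong₂ _*_ eq eq′ ⟩
  (b * r) * (b′ * r′)   ≡⟨ interchange b r b′ r′ ⟩
  (b * b′) * (r * r′)   ∎)
  where open ≡-Reasoning

scaled-weight : ∀ c {a b r d} → a ≐ b · r ÷ d → a * c ≐ b · r * c ÷ d
scaled-weight c {a} {b} {r} {d} (scaled eq) = scaled (begin
  (a * c) * d   ≡⟨ xy∙z≈xz∙y a c d ⟩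
  (a * d) * c   ≡⟨ cong (_* c) eq ⟩
  (b * r) * c   ≡⟨ ℚP.*-assoc b r c ⟩
  b * (r * c)   ∎)
  where open ≡-Reasoning

-- Binomial coefficients with rational upper argument

binom-suc : ∀ y m → binom y (suc m) ≐ binom y m · y - ⟦ m ⟧ ÷ ⟦ suc m ⟧
binom-suc y m = scaled (begin
  fall y m * (y - ⟦ m ⟧) * r[m+1] * ⟦ suc m ⟧    ≡⟨ reorder (fall y m) (y - ⟦ m ⟧) r[m+1] ⟦ suc m ⟧ ⟩
  fall y m * (r[m+1] * ⟦ suc m ⟧) * (y - ⟦ m ⟧)  ≡⟨ cong (λ r → fall y m * r * (y - ⟦ m ⟧)) (recip-*ˡ (suc m) (m !) {{_}} {{m !≢0}}) ⟩
  binom y m * (y - ⟦ m ⟧)                        ∎)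
  where
  open ≡-Reasoning
  r[m+1] : ℚ
  r[m+1] = (ℤ.+ 1 / (suc m !)) {{suc m !≢0}}
  reorder : ∀ a b c d → a * b * c * d ≡ a * (c * d) * b
  reorder = solve-∀ ℚ-ring

fall-shift : ∀ y m → fall (y + 1) (suc m) ≡ (y + 1) * fall y m
fall-shift y zero    = ring′ y
  where ring′ : ∀ y → 1 * (y + 1 - 0) ≡ (y + 1) * 1
        ring′ = solve-∀ ℚ-ring
fall-shift y (suc m) = begin
  fall (y + 1) (suc m) * (y + 1 - ⟦ suc m ⟧)   ≡⟨ cong₂ (λ a b → a * (y + 1 - b)) (fall-shift y m) (⟦suc⟧ m) ⟩
  (y + 1) * fall y m * (y + 1 - (⟦ m ⟧ + 1))   ≡⟨ ring′ y (fall y m) ⟦ m ⟧ ⟩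
  (y + 1) * fall y (suc m)                     ∎
  where
  open ≡-Reasoning
  ring′ : ∀ y f m → (y + 1) * f * (y + 1 - (m + 1)) ≡ (y + 1) * (f * (y - m))
  ring′ = solve-∀ ℚ-ring

binom-absorb : ∀ y m → binom (y + 1) (suc m) * ⟦ suc m ⟧ ≡ (y + 1) * binom y m
binom-absorb y m = begin
  fall (y + 1) (suc m) * r[m+1] * ⟦ suc m ⟧  ≡⟨ cong (λ f → f * r[m+1] * ⟦ suc m ⟧) (fall-shift y m) ⟩
  (y + 1) * fall y m * r[m+1] * ⟦ suc m ⟧    ≡⟨ reorder (y + 1) (fall y m) r[m+1] ⟦ suc m ⟧ ⟩
  (y + 1) * (fall y m * (r[m+1] * ⟦ suc m ⟧)) ≡⟨ cong (λ r → (y + 1) * (fall y m * r)) (recip-*ˡ (suc m) (m !) {{_}} {{m !≢0}}) ⟩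
  (y + 1) * binom y m                        ∎
  where
  open ≡-Reasoning
  r[m+1] : ℚ
  r[m+1] = (ℤ.+ 1 / (suc m !)) {{suc m !≢0}}
  reorder : ∀ a b c d → a * b * c * d ≡ a * (b * (c * d))
  reorder = solve-∀ ℚ-ring

binom-upper-suc : ∀ y m → binom (y + 1) m * (y + 1 - ⟦ m ⟧) ≡ (y + 1) * binom y m
binom-upper-suc y m = trans (sym (unscale (binom-suc (y + 1) m))) (binom-absorb y m)

pascal : ∀ y m → binom (y + 1) (suc m) ≡ binom y (suc m) + binom y m
pascal y m = *-cancelʳ-≡ ⟦ suc m ⟧ (⟦suc⟧≢0 m) (begin
  binom (y + 1) (suc m) * ⟦ suc m ⟧                     ≡⟨ binom-absorb y m ⟩
  (y + 1) * binom y m                                   ≡⟨ split (binom y m) y ⟦ m ⟧ ⟩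
  binom y m * (y - ⟦ m ⟧) + binom y m * (⟦ m ⟧ + 1)     ≡⟨ cong₂ _+_ (unscale (binom-suc y m)) (cong (binom y m *_) (⟦suc⟧ m)) ⟨
  binom y (suc m) * ⟦ suc m ⟧ + binom y m * ⟦ suc m ⟧   ≡⟨ ℚP.*-distribʳ-+ ⟦ suc m ⟧ (binom y (suc m)) (binom y m) ⟨
  (binom y (suc m) + binom y m) * ⟦ suc m ⟧             ∎)
  where
  open ≡-Reasoning
  split : ∀ b y m → (y + 1) * b ≡ b * (y - m) + b * (m + 1)
  split = solve-∀ ℚ-ring

binom-suc≡0 : ∀ y m → binom y m * (y - ⟦ m ⟧) ≡ 0ℚ → binom y (suc m) ≡ 0ℚ
binom-suc≡0 y m eq =
  *-cancelʳ-≡ ⟦ suc m ⟧ (⟦suc⟧≢0 m) (trans (unscale (binom-suc y m)) (trans eq (sym (ℚP.*-zeroˡ ⟦ suc m ⟧))))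

binom-vanish : ∀ {n m} → n < m → binom ⟦ n ⟧ m ≡ 0ℚ
binom-vanish {n} {suc m} (s≤s n≤m) with ℕP.m≤n⇒m<n∨m≡n n≤m
... | inj₁ n<m  = binom-suc≡0 ⟦ n ⟧ m (trans (cong (_* (⟦ n ⟧ - ⟦ m ⟧)) (binom-vanish n<m)) (ℚP.*-zeroˡ (⟦ n ⟧ - ⟦ m ⟧)))
... | inj₂ refl = binom-suc≡0 ⟦ n ⟧ n (trans (cong (binom ⟦ n ⟧ n *_) (ℚP.+-inverseʳ ⟦ n ⟧)) (ℚP.*-zeroʳ (binom ⟦ n ⟧ n)))

binom-diag : ∀ n → binom ⟦ n ⟧ n ≡ 1ℚ
binom-diag zero    = refl
binom-diag (suc n) = *-cancelʳ-≡ ⟦ suc n ⟧ (⟦suc⟧≢0 n) (begin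
  binom ⟦ suc n ⟧ (suc n) * ⟦ suc n ⟧     ≡⟨ cong (λ y → binom y (suc n) * ⟦ suc n ⟧) (⟦suc⟧ n) ⟩
  binom (⟦ n ⟧ + 1) (suc n) * ⟦ suc n ⟧   ≡⟨ binom-absorb ⟦ n ⟧ n ⟩
  (⟦ n ⟧ + 1) * binom ⟦ n ⟧ n             ≡⟨ cong ((⟦ n ⟧ + 1) *_) (binom-diag n) ⟩
  (⟦ n ⟧ + 1) * 1ℚ                        ≡⟨ ℚP.*-comm (⟦ n ⟧ + 1) 1ℚ ⟩
  1ℚ * (⟦ n ⟧ + 1)                        ≡⟨ cong (1ℚ *_) (⟦suc⟧ n) ⟨
  1ℚ * ⟦ suc n ⟧                          ∎)
  where open ≡-Reasoning

binom-1 : ∀ y → binom y 1 ≡ y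
binom-1 y = trans (sym (ℚP.*-identityʳ (binom y 1))) (trans (unscale (binom-suc y 0)) (ring′ y))
  where ring′ : ∀ y → 1 * (y - 0) ≡ y
        ring′ = solve-∀ ℚ-ring

sq-* : ∀ a b → sq (a * b) ≡ sq a * sq b
sq-* = expanded
  where expanded : ∀ a b → (a * b) * (a * b) ≡ (a * a) * (b * b)
        expanded = solve-∀ ℚ-ring

sq-cancelʳ : ∀ a b c → c ≢ 0ℚ → sq (a * c) ≡ sq (b * c) → sq a ≡ sq b
sq-cancelʳ a b c c≢0 eq =
  *-cancelʳ-≡ c c≢0 (*-cancelʳ-≡ c c≢0 (trans (sym (reorder a c)) (trans eq (reorder b c))))
  where reorder : ∀ a c → (a * c) * (a * c) ≡ a * a * c * c
        reorder = solve-∀ ℚ-ring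

sq-binom-neg : ∀ y j → sq (binom (- y - 1ℚ) j) ≡ sq (binom (y + ⟦ j ⟧) j)
sq-binom-neg y zero    = refl
sq-binom-neg y (suc j) = sq-cancelʳ (binom (- y - 1ℚ) (suc j)) (binom (y + ⟦ suc j ⟧) (suc j)) ⟦ suc j ⟧ (⟦suc⟧≢0 j) (begin
  sq (binom (- y - 1ℚ) (suc j) * ⟦ suc j ⟧)        ≡⟨ cong sq (unscale (binom-suc (- y - 1ℚ) j)) ⟩
  sq (binom (- y - 1ℚ) j * (- y - 1ℚ - ⟦ j ⟧))     ≡⟨ sq-* (binom (- y - 1ℚ) j) _ ⟩
  sq (binom (- y - 1ℚ) j) * sq (- y - 1ℚ - ⟦ j ⟧)  ≡⟨ cong (_* sq (- y - 1ℚ - ⟦ j ⟧)) (sq-binom-neg y j) ⟩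
  sq (binom (y + ⟦ j ⟧) j) * sq (- y - 1ℚ - ⟦ j ⟧) ≡⟨ flip-sign (binom (y + ⟦ j ⟧) j) y ⟦ j ⟧ ⟩
  sq ((y + ⟦ j ⟧ + 1) * binom (y + ⟦ j ⟧) j)       ≡⟨ cong sq (binom-absorb (y + ⟦ j ⟧) j) ⟨
  sq (binom (y + ⟦ j ⟧ + 1) (suc j) * ⟦ suc j ⟧)   ≡⟨ cong (λ t → sq (binom t (suc j) * ⟦ suc j ⟧)) (+⟦suc⟧ y j) ⟨
  sq (binom (y + ⟦ suc j ⟧) (suc j) * ⟦ suc j ⟧)   ∎)
  where
  open ≡-Reasoning
  flip-sign : ∀ b y j → b * b * ((- y - 1ℚ - j) * (- y - 1ℚ - j)) ≡ ((y + j + 1) * b) * ((y + j + 1) * b)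
  flip-sign = solve-∀ ℚ-ring

binom-upper-sucℕ : ∀ n j → binom ⟦ n ⟧ j ≐ binom ⟦ suc n ⟧ j · ⟦ suc n ⟧ - ⟦ j ⟧ ÷ ⟦ suc n ⟧
binom-upper-sucℕ n j = scaled (begin
  binom ⟦ n ⟧ j * ⟦ suc n ⟧                 ≡⟨ ℚP.*-comm (binom ⟦ n ⟧ j) ⟦ suc n ⟧ ⟩
  ⟦ suc n ⟧ * binom ⟦ n ⟧ j                 ≡⟨ subst (λ t → t * binom ⟦ n ⟧ j ≡ binom t j * (t - ⟦ j ⟧))
                                                     (sym (⟦suc⟧ n)) (sym (binom-upper-suc ⟦ n ⟧ j)) ⟩
  binom ⟦ suc n ⟧ j * (⟦ suc n ⟧ - ⟦ j ⟧)   ∎)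
  where open ≡-Reasoning

binom-absorbℕ : ∀ n m → binom ⟦ n ⟧ m ≐ binom ⟦ suc n ⟧ (suc m) · ⟦ suc m ⟧ ÷ ⟦ suc n ⟧
binom-absorbℕ n m = scaled (begin
  binom ⟦ n ⟧ m * ⟦ suc n ⟧                 ≡⟨ ℚP.*-comm (binom ⟦ n ⟧ m) ⟦ suc n ⟧ ⟩
  ⟦ suc n ⟧ * binom ⟦ n ⟧ m                 ≡⟨ subst (λ t → t * binom ⟦ n ⟧ m ≡ binom t (suc m) * ⟦ suc m ⟧)
                                                     (sym (⟦suc⟧ n)) (sym (binom-absorb ⟦ n ⟧ m)) ⟩
  binom ⟦ suc n ⟧ (suc m) * ⟦ suc m ⟧       ∎)
  where open ≡-Reasoning

binom-absorb-shift : ∀ y n k → binom (y + ⟦ suc n ⟧) (suc k) ≐ binom (y + ⟦ n ⟧) k · y + ⟦ suc n ⟧ ÷ ⟦ suc k ⟧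
binom-absorb-shift y n k = scaled (begin
  binom (y + ⟦ suc n ⟧) (suc k) * ⟦ suc k ⟧   ≡⟨ cong (λ t → binom t (suc k) * ⟦ suc k ⟧) (+⟦suc⟧ y n) ⟩
  binom (y + ⟦ n ⟧ + 1) (suc k) * ⟦ suc k ⟧   ≡⟨ binom-absorb (y + ⟦ n ⟧) k ⟩
  (y + ⟦ n ⟧ + 1) * binom (y + ⟦ n ⟧) k       ≡⟨ ℚP.*-comm (y + ⟦ n ⟧ + 1) _ ⟩
  binom (y + ⟦ n ⟧) k * (y + ⟦ n ⟧ + 1)       ≡⟨ cong (binom (y + ⟦ n ⟧) k *_) (+⟦suc⟧ y n) ⟨
  binom (y + ⟦ n ⟧) k * (y + ⟦ suc n ⟧)       ∎)
  where open ≡-Reasoning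

⟦suc⟧-as-difference : ∀ n j → ⟦ suc n ⟧ ≡ ⟦ suc (n ℕ.+ j) ⟧ - ⟦ j ⟧
⟦suc⟧-as-difference n j = trans (sym (cancel ⟦ suc n ⟧ ⟦ j ⟧)) (cong (_- ⟦ j ⟧) (sym (⟦+⟧ (suc n) j)))
  where cancel : ∀ a b → a + b - b ≡ a
        cancel = solve-∀ ℚ-ring

binom-upper-shift : ∀ n j → binom ⟦ suc (n ℕ.+ j) ⟧ j ≐ binom ⟦ n ℕ.+ j ⟧ j · ⟦ suc (n ℕ.+ j) ⟧ ÷ ⟦ suc n ⟧
binom-upper-shift n j = scaled (begin
  binom ⟦ suc (n ℕ.+ j) ⟧ j * ⟦ suc n ⟧                      ≡⟨ cong (binom ⟦ suc (n ℕ.+ j) ⟧ j *_) (⟦suc⟧-as-difference n j) ⟩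
  binom ⟦ suc (n ℕ.+ j) ⟧ j * (⟦ suc (n ℕ.+ j) ⟧ - ⟦ j ⟧)    ≡⟨ unscale (binom-upper-sucℕ (n ℕ.+ j) j) ⟨
  binom ⟦ n ℕ.+ j ⟧ j * ⟦ suc (n ℕ.+ j) ⟧                    ∎)
  where open ≡-Reasoning

binom-lower-shift : ∀ n i → binom ⟦ suc (n ℕ.+ i) ⟧ i ≐ binom ⟦ n ℕ.+ suc i ⟧ (suc i) · ⟦ suc i ⟧ ÷ ⟦ suc n ⟧
binom-lower-shift n i = scaled (begin
  binom ⟦ suc (n ℕ.+ i) ⟧ i * ⟦ suc n ⟧                    ≡⟨ cong (binom ⟦ suc (n ℕ.+ i) ⟧ i *_) (⟦suc⟧-as-difference n i) ⟩
  binom ⟦ suc (n ℕ.+ i) ⟧ i * (⟦ suc (n ℕ.+ i) ⟧ - ⟦ i ⟧)  ≡⟨ unscale (binom-suc ⟦ suc (n ℕ.+ i) ⟧ i) ⟨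
  binom ⟦ suc (n ℕ.+ i) ⟧ (suc i) * ⟦ suc i ⟧              ≡⟨ cong (λ t → binom ⟦ t ⟧ (suc i) * ⟦ suc i ⟧) (ℕP.+-suc n i) ⟨
  binom ⟦ n ℕ.+ suc i ⟧ (suc i) * ⟦ suc i ⟧                ∎)
  where open ≡-Reasoning

binom-trinomial : ∀ y j m → binom (y + ⟦ j ⟧) j * binom y m ≡ binom ⟦ m ℕ.+ j ⟧ j * binom (y + ⟦ j ⟧) (m ℕ.+ j)
binom-trinomial y j zero = begin
  binom (y + ⟦ j ⟧) j * 1ℚ              ≡⟨ ℚP.*-identityʳ _ ⟩
  binom (y + ⟦ j ⟧) j                   ≡⟨ ℚP.*-identityˡ _ ⟨
  1ℚ * binom (y + ⟦ j ⟧) j              ≡⟨ cong (_* binom (y + ⟦ j ⟧) j) (binom-diag j) ⟨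
  binom ⟦ j ⟧ j * binom (y + ⟦ j ⟧) j   ∎
  where open ≡-Reasoning
binom-trinomial y j (suc m) =
  *-cancelʳ-≡ ⟦ suc k ⟧ (⟦suc⟧≢0 k) (*-cancelʳ-≡ ⟦ suc m ⟧ (⟦suc⟧≢0 m) (begin
    bX * binom y (suc m) * ⟦ suc k ⟧ * ⟦ suc m ⟧                    ≡⟨ assoc₄ bX _ _ _ ⟩
    bX * (binom y (suc m) * ⟦ suc m ⟧) * ⟦ suc k ⟧                  ≡⟨ cong (λ t → bX * t * ⟦ suc k ⟧) (unscale (binom-suc y m)) ⟩
    bX * (binom y m * (y - ⟦ m ⟧)) * ⟦ suc k ⟧                      ≡⟨ cong (_* ⟦ suc k ⟧) (ℚP.*-assoc bX _ _) ⟨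
    bX * binom y m * (y - ⟦ m ⟧) * ⟦ suc k ⟧                        ≡⟨ cong (λ t → t * (y - ⟦ m ⟧) * ⟦ suc k ⟧) (binom-trinomial y j m) ⟩
    binom ⟦ k ⟧ j * binom X k * (y - ⟦ m ⟧) * ⟦ suc k ⟧             ≡⟨ regroup (binom ⟦ k ⟧ j) (binom X k) (y - ⟦ m ⟧) ⟦ suc k ⟧ ⟩
    (binom ⟦ k ⟧ j * ⟦ suc k ⟧) * (binom X k * (y - ⟦ m ⟧))         ≡⟨ cong₂ _*_ (unscale (binom-upper-shift m j)) lower ⟨
    (binom ⟦ suc k ⟧ j * ⟦ suc m ⟧) * (binom X (suc k) * ⟦ suc k ⟧) ≡⟨ regroup′ (binom ⟦ suc k ⟧ j) _ ⟦ suc m ⟧ ⟦ suc k ⟧ ⟩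
    binom ⟦ suc k ⟧ j * binom X (suc k) * ⟦ suc k ⟧ * ⟦ suc m ⟧     ∎))
  where
  open ≡-Reasoning
  k : ℕ
  k = m ℕ.+ j
  X bX : ℚ
  X = y + ⟦ j ⟧
  bX = binom X j
  assoc₄ : ∀ a b c d → a * b * c * d ≡ a * (b * d) * c
  assoc₄ = solve-∀ ℚ-ring
  regroup : ∀ a b c d → a * b * c * d ≡ (a * d) * (b * c)
  regroup = solve-∀ ℚ-ring
  regroup′ : ∀ a b c d → (a * c) * (b * d) ≡ a * b * d * c
  regroup′ = solve-∀ ℚ-ring
  lower : binom X (suc k) * ⟦ suc k ⟧ ≡ binom X k * (y - ⟦ m ⟧)
  lower = trans (unscale (binom-suc X k)) (cong (binom X k *_) (trans (cong (λ t → X - t) (⟦+⟧ m j)) (cancel y ⟦ j ⟧ ⟦ m ⟧)))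
    where cancel : ∀ y j m → y + j - (m + j) ≡ y - m
          cancel = solve-∀ ℚ-ring

sumUpTo-cong : ∀ n {f g : ℕ → ℚ} → (∀ j → j ℕ.≤ n → f j ≡ g j) → sumUpTo n f ≡ sumUpTo n g
sumUpTo-cong zero    f≗g = f≗g 0 ℕ.z≤n
sumUpTo-cong (suc n) f≗g = cong₂ _+_ (sumUpTo-cong n (λ j j≤n → f≗g j (ℕP.m≤n⇒m≤1+n j≤n))) (f≗g (suc n) ℕP.≤-refl)

sumUpTo-+ : ∀ n (f g : ℕ → ℚ) → sumUpTo n (λ j → f j + g j) ≡ sumUpTo n f + sumUpTo n g
sumUpTo-+ zero    f g = refl
sumUpTo-+ (suc n) f g = trans (cong (_+ (f (suc n) + g (suc n))) (sumUpTo-+ n f g)) (+-interchange (sumUpTo n f) (sumUpTo n g) (f (suc n)) (g (suc n)))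
  where +-interchange : ∀ a b c d → (a + b) + (c + d) ≡ (a + c) + (b + d)
        +-interchange = solve-∀ ℚ-ring

sumUpTo-*ˡ : ∀ n c (f : ℕ → ℚ) → sumUpTo n (λ j → c * f j) ≡ c * sumUpTo n f
sumUpTo-*ˡ zero    c f = refl
sumUpTo-*ˡ (suc n) c f = trans (cong (_+ c * f (suc n)) (sumUpTo-*ˡ n c f)) (sym (ℚP.*-distribˡ-+ c (sumUpTo n f) (f (suc n))))

sumUpTo-telescope : ∀ n (g : ℕ → ℚ) → sumUpTo n (λ j → g (suc j) - g j) ≡ g (suc n) - g 0
sumUpTo-telescope zero    g = refl
sumUpTo-telescope (suc n) g = trans (cong (_+ (g (suc (suc n)) - g (suc n))) (sumUpTo-telescope n g)) (collapse (g (suc (suc n))) (g (suc n)) (g 0))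
  where collapse : ∀ a b c → (b - c) + (a - b) ≡ a - c
        collapse = solve-∀ ℚ-ring

sumUpTo-suc-vanish : ∀ n (f : ℕ → ℚ) → f (suc n) ≡ 0ℚ → sumUpTo (suc n) f ≡ sumUpTo n f
sumUpTo-suc-vanish n f f[n+1]≡0 = trans (cong (sumUpTo n f +_) f[n+1]≡0) (ℚP.+-identityʳ (sumUpTo n f))

sumBelow-cong : ∀ n {f g : ℕ → ℚ} → (∀ k → f k ≡ g k) → sumBelow n f ≡ sumBelow n g
sumBelow-cong zero    f≗g = refl
sumBelow-cong (suc n) f≗g = cong₂ _+_ (sumBelow-cong n f≗g) (f≗g n)

creative-telescoping : ∀ n (p₀ p₁ p₂ : ℚ) (f₀ f₁ f₂ g : ℕ → ℚ) →
  (∀ j → p₀ * f₀ j + p₁ * f₁ j + p₂ * f₂ j ≡ g (suc j) - g j) →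
  (∀ j → n < j → f₀ j ≡ 0ℚ) → (∀ j → suc n < j → f₁ j ≡ 0ℚ) →
  g 0 ≡ 0ℚ → g (suc (suc (suc n))) ≡ 0ℚ →
  p₀ * sumUpTo n f₀ + p₁ * sumUpTo (suc n) f₁ + p₂ * sumUpTo (suc (suc n)) f₂ ≡ 0ℚ
creative-telescoping n p₀ p₁ p₂ f₀ f₁ f₂ g cert f₀-vanish f₁-vanish g₀ g[n+3] = begin
  p₀ * sumUpTo n f₀ + p₁ * sumUpTo (suc n) f₁ + p₂ * Σ f₂
    ≡⟨ cong₂ (λ s t → p₀ * s + p₁ * t + p₂ * Σ f₂) extend₀ extend₁ ⟩
  p₀ * Σ f₀ + p₁ * Σ f₁ + p₂ * Σ f₂
    ≡⟨ linear ⟨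
  Σ (λ j → p₀ * f₀ j + p₁ * f₁ j + p₂ * f₂ j)
    ≡⟨ sumUpTo-cong (suc (suc n)) (λ j _ → cert j) ⟩
  Σ (λ j → g (suc j) - g j)
    ≡⟨ sumUpTo-telescope (suc (suc n)) g ⟩
  g (suc (suc (suc n))) - g 0
    ≡⟨ cong₂ _-_ g[n+3] g₀ ⟩
  0ℚ ∎
  where
  open ≡-Reasoning
  Σ : (ℕ → ℚ) → ℚ
  Σ = sumUpTo (suc (suc n))
  extend₀ : sumUpTo n f₀ ≡ Σ f₀
  extend₀ = sym (trans (sumUpTo-suc-vanish (suc n) f₀ (f₀-vanish _ (ℕP.m<n⇒m<1+n (ℕP.n<1+n n))))
                       (sumUpTo-suc-vanish n f₀ (f₀-vanish _ (ℕP.n<1+n n))))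
  extend₁ : sumUpTo (suc n) f₁ ≡ Σ f₁
  extend₁ = sym (sumUpTo-suc-vanish (suc n) f₁ (f₁-vanish _ (ℕP.n<1+n (suc n))))
  linear : Σ (λ j → p₀ * f₀ j + p₁ * f₁ j + p₂ * f₂ j) ≡ p₀ * Σ f₀ + p₁ * Σ f₁ + p₂ * Σ f₂
  linear = begin
    Σ (λ j → p₀ * f₀ j + p₁ * f₁ j + p₂ * f₂ j)            ≡⟨ sumUpTo-+ (suc (suc n)) (λ j → p₀ * f₀ j + p₁ * f₁ j) (λ j → p₂ * f₂ j) ⟩
    Σ (λ j → p₀ * f₀ j + p₁ * f₁ j) + Σ (λ j → p₂ * f₂ j)  ≡⟨ cong (_+ Σ (λ j → p₂ * f₂ j)) (sumUpTo-+ (suc (suc n)) (λ j → p₀ * f₀ j) (λ j → p₁ * f₁ j)) ⟩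
    Σ (λ j → p₀ * f₀ j) + Σ (λ j → p₁ * f₁ j) + Σ (λ j → p₂ * f₂ j)
      ≡⟨ cong₂ _+_ (cong₂ _+_ (sumUpTo-*ˡ (suc (suc n)) p₀ f₀) (sumUpTo-*ˡ (suc (suc n)) p₁ f₁)) (sumUpTo-*ˡ (suc (suc n)) p₂ f₂) ⟩
    p₀ * Σ f₀ + p₁ * Σ f₁ + p₂ * Σ f₂                      ∎

SolvesRecurrence : (p₀ p₁ p₂ : ℕ → ℚ) → (ℕ → ℚ) → Set
SolvesRecurrence p₀ p₁ p₂ u = ∀ k → p₀ k * u k + p₁ k * u (suc k) + p₂ k * u (suc (suc k)) ≡ 0ℚ

recurrence-unique : ∀ {p₀ p₁ p₂ : ℕ → ℚ} {u v : ℕ → ℚ} → (∀ k → p₂ k ≢ 0ℚ) →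
  SolvesRecurrence p₀ p₁ p₂ u → SolvesRecurrence p₀ p₁ p₂ v →
  u 0 ≡ v 0 → u 1 ≡ v 1 → ∀ k → u k ≡ v k
recurrence-unique {p₀} {p₁} {p₂} {u} {v} p₂≢0 u-rec v-rec u₀≡v₀ u₁≡v₁ k = proj₁ (agree k)
  where
  isolate : ∀ p₀ p₁ p₂ a b c → c * p₂ ≡ (p₀ * a + p₁ * b + p₂ * c) - (p₀ * a + p₁ * b)
  isolate = solve-∀ ℚ-ring
  agree : ∀ k → u k ≡ v k × u (suc k) ≡ v (suc k)
  agree zero    = u₀≡v₀ , u₁≡v₁
  agree (suc k) with agree k
  ... | uₖ≡vₖ , uₖ₊₁≡vₖ₊₁ = uₖ₊₁≡vₖ₊₁ , *-cancelʳ-≡ (p₂ k) (p₂≢0 k) (begin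
    u (suc (suc k)) * p₂ k
      ≡⟨ isolate (p₀ k) (p₁ k) (p₂ k) (u k) (u (suc k)) _ ⟩
    (p₀ k * u k + p₁ k * u (suc k) + p₂ k * u (suc (suc k))) - (p₀ k * u k + p₁ k * u (suc k))
      ≡⟨ cong₂ (λ s t → s - (p₀ k * t + p₁ k * u (suc k))) (trans (u-rec k) (sym (v-rec k))) uₖ≡vₖ ⟩
    (p₀ k * v k + p₁ k * v (suc k) + p₂ k * v (suc (suc k))) - (p₀ k * v k + p₁ k * u (suc k))
      ≡⟨ cong (λ t → (p₀ k * v k + p₁ k * v (suc k) + p₂ k * v (suc (suc k))) - (p₀ k * v k + p₁ k * t)) uₖ₊₁≡vₖ₊₁ ⟩
    (p₀ k * v k + p₁ k * v (suc k) + p₂ k * v (suc (suc k))) - (p₀ k * v k + p₁ k * v (suc k))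
      ≡⟨ isolate (p₀ k) (p₁ k) (p₂ k) (v k) (v (suc k)) _ ⟨
    v (suc (suc k)) * p₂ k ∎)
    where open ≡-Reasoning

-- A relation all of whose terms are known multiples of one common term reduces to an
-- identity between the multipliers.
certificate-scaled : ∀ {D β} p₀ p₁ p₂ {a₀ a₁ a₂ g₀ g₁ r₀ r₁ r₂ s₀ s₁} → D ≢ 0ℚ →
  a₀ ≐ β · r₀ ÷ D → a₁ ≐ β · r₁ ÷ D → a₂ ≐ β · r₂ ÷ D → g₀ ≐ β · s₀ ÷ D → g₁ ≐ β · s₁ ÷ D →
  p₀ * r₀ + p₁ * r₁ + p₂ * r₂ ≡ s₁ - s₀ →
  p₀ * a₀ + p₁ * a₁ + p₂ * a₂ ≡ g₁ - g₀
certificate-scaled {D} {β} p₀ p₁ p₂ {a₀} {a₁} {a₂} {g₀} {g₁} {r₀} {r₁} {r₂} {s₀} {s₁}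
                   D≢0 (scaled e₀) (scaled e₁) (scaled e₂) (scaled f₀) (scaled f₁) identity =
  *-cancelʳ-≡ D D≢0 (begin
    (p₀ * a₀ + p₁ * a₁ + p₂ * a₂) * D                ≡⟨ distrib₃ p₀ p₁ p₂ a₀ a₁ a₂ D ⟩
    p₀ * (a₀ * D) + p₁ * (a₁ * D) + p₂ * (a₂ * D)    ≡⟨ cong₂ _+_ (cong₂ _+_ (cong (p₀ *_) e₀) (cong (p₁ *_) e₁)) (cong (p₂ *_) e₂) ⟩
    p₀ * (β * r₀) + p₁ * (β * r₁) + p₂ * (β * r₂)    ≡⟨ factor p₀ p₁ p₂ β r₀ r₁ r₂ ⟩
    β * (p₀ * r₀ + p₁ * r₁ + p₂ * r₂)                ≡⟨ cong (β *_) identity ⟩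
    β * (s₁ - s₀)                                    ≡⟨ difference β s₁ s₀ ⟩
    β * s₁ - β * s₀                                  ≡⟨ cong₂ _-_ f₁ f₀ ⟨
    g₁ * D - g₀ * D                                  ≡⟨ difference′ g₁ g₀ D ⟩
    (g₁ - g₀) * D                                    ∎)
  where
  open ≡-Reasoning
  distrib₃ : ∀ p₀ p₁ p₂ a₀ a₁ a₂ D → (p₀ * a₀ + p₁ * a₁ + p₂ * a₂) * D ≡ p₀ * (a₀ * D) + p₁ * (a₁ * D) + p₂ * (a₂ * D)
  distrib₃ = solve-∀ ℚ-ring
  factor : ∀ p₀ p₁ p₂ β r₀ r₁ r₂ → p₀ * (β * r₀) + p₁ * (β * r₁) + p₂ * (β * r₂) ≡ β * (p₀ * r₀ + p₁ * r₁ + p₂ * r₂)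
  factor = solve-∀ ℚ-ring
  difference : ∀ β s t → β * (s - t) ≡ β * s - β * t
  difference = solve-∀ ℚ-ring
  difference′ : ∀ a b D → a * D - b * D ≡ (a - b) * D
  difference′ = solve-∀ ℚ-ring

*-≢0 : ∀ {p q} → p ≢ 0ℚ → q ≢ 0ℚ → p * q ≢ 0ℚ
*-≢0 {p} {q} p≢0 q≢0 pq≡0 = p≢0 (*-cancelʳ-≡ q q≢0 (trans pq≡0 (sym (ℚP.*-zeroˡ q))))

rec₀ rec₂ : ℕ → ℚ
rec₀ k = (⟦ k ⟧ + 1) * (⟦ k ⟧ + 1) * (⟦ k ⟧ + 1)
rec₂ k = (⟦ k ⟧ + 2) * (⟦ k ⟧ + 2) * (⟦ k ⟧ + 2)

rec₁ : ℚ → ℕ → ℚ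
rec₁ x k = - ((2 * ⟦ k ⟧ + 3) * (⟦ k ⟧ * ⟦ k ⟧ + 3 * ⟦ k ⟧ + 3 + 2 * x * (x + 1)))

rec₂≢0 : ∀ k → rec₂ k ≢ 0ℚ
rec₂≢0 k = subst (λ t → t * t * t ≢ 0ℚ) (⟦2+⟧ k) (*-≢0 (*-≢0 K₂≢0 K₂≢0) K₂≢0)
  where K₂≢0 : ⟦ suc (suc k) ⟧ ≢ 0ℚ
        K₂≢0 = ⟦suc⟧≢0 (suc k)

binom-upper-suc² : ∀ n j → binom ⟦ n ⟧ j ≐ binom ⟦ suc (suc n) ⟧ j · (⟦ suc n ⟧ - ⟦ j ⟧) * (⟦ suc (suc n) ⟧ - ⟦ j ⟧)
                                             ÷ ⟦ suc (suc n) ⟧ * ⟦ suc n ⟧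
binom-upper-suc² n j = subst (binom ⟦ n ⟧ j ≐ binom ⟦ suc (suc n) ⟧ j · (⟦ suc n ⟧ - ⟦ j ⟧) * (⟦ suc (suc n) ⟧ - ⟦ j ⟧) ÷_)
                             (ℚP.*-comm ⟦ suc n ⟧ ⟦ suc (suc n) ⟧)
                             (scaled-trans (binom-upper-sucℕ n j) (binom-upper-sucℕ (suc n) j))

binom-suc² : ∀ y k → binom y (suc (suc k)) ≐ binom y k · (y - ⟦ suc k ⟧) * (y - ⟦ k ⟧) ÷ ⟦ suc (suc k) ⟧ * ⟦ suc k ⟧
binom-suc² y k = scaled-trans (binom-suc y (suc k)) (binom-suc y k)

-- The sum  Σⱼ (k choose j)² (x+j choose k)²

summandF : ℚ → ℕ → ℕ → ℚ
summandF x k j = sq (binom ⟦ k ⟧ j * binom (x + ⟦ j ⟧) k)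

weightF : ℚ → ℚ → ℚ → ℚ
weightF k j x = 6 - 6 * j + j * j + 4 * x - 8 * x * j + 2 * x * j * j - 6 * x * x + 2 * x * x * j
            + 9 * k - 4 * k * j + 10 * k * x - 6 * k * x * j - 3 * k * x * x + 3 * k * k + 4 * k * k * x

-- certificateF and certificateH are the certificates produced by Zeilberger's algorithm.
certificateF : ℚ → ℕ → ℕ → ℚ
certificateF x k zero    = 0ℚ
certificateF x k (suc j) = sq (binom ⟦ suc k ⟧ j * binom (x + ⟦ suc j ⟧) (suc k)) * weightF ⟦ k ⟧ ⟦ suc j ⟧ x

-- K₁, K₂, J₁ stand for ⟦ suc k ⟧, ⟦ suc (suc k) ⟧, ⟦ suc j ⟧, so that no rewriting is needed
-- when the identity is applied; sq and the weight are let-bound because the ring solver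
-- treats defined functions as opaque constants.
identityF : ∀ K K₁ K₂ J J₁ x → K₁ ≡ K + 1 → K₂ ≡ K + 2 → J₁ ≡ J + 1 →
  let sq : ℚ → ℚ
      sq a = a * a
      q : ℚ → ℚ
      q j = 6 - 6 * j + j * j + 4 * x - 8 * x * j + 2 * x * j * j - 6 * x * x + 2 * x * x * j
            + 9 * K - 4 * K * j + 10 * K * x - 6 * K * x * j - 3 * K * x * x + 3 * K * K + 4 * K * K * x
  in (K + 1) * (K + 1) * (K + 1) * sq ((K₁ - J) * (K₂ - J))
     + - ((2 * K + 3) * (K * K + 3 * K + 3 + 2 * x * (x + 1))) * sq ((K₂ - J) * (x + J - K))
     + (K + 2) * (K + 2) * (K + 2) * sq ((x + J - K₁) * (x + J - K))
     ≡ sq ((K₂ - J) * (x + J₁)) * q J₁ - sq (J * (x + J - K)) * q J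
identityF K .(K + 1) .(K + 2) J .(J + 1) x refl refl refl = solve (K ∷ J ∷ x ∷ []) ℚ-ring

certificateF-telescopes : ∀ x k j →
  rec₀ k * summandF x k j + rec₁ x k * summandF x (suc k) j + rec₂ k * summandF x (suc (suc k)) j
  ≡ certificateF x k (suc j) - certificateF x k j
certificateF-telescopes x k j =
  certificate-scaled (rec₀ k) (rec₁ x k) (rec₂ k) (*-≢0 D₁≢0 D₁≢0)
    (scaled-sq (scaled-*ʳ (binom (x + ⟦ j ⟧) k) (binom-upper-suc² k j)))
    (scaled-sq (scaled-* (binom-upper-sucℕ (suc k) j) (binom-suc (x + ⟦ j ⟧) k)))
    (scaled-sq (scaled-*ˡ (binom ⟦ suc (suc k) ⟧ j) (binom-suc² (x + ⟦ j ⟧) k)))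
    (lower-end j)
    (scaled-weight (weightF ⟦ k ⟧ ⟦ suc j ⟧ x) (scaled-sq (scaled-* (binom-upper-sucℕ (suc k) j) (binom-absorb-shift x j k))))
    (identityF ⟦ k ⟧ ⟦ suc k ⟧ ⟦ suc (suc k) ⟧ ⟦ j ⟧ ⟦ suc j ⟧ x (⟦suc⟧ k) (⟦2+⟧ k) (⟦suc⟧ j))
  where
  D₁≢0 : ⟦ suc (suc k) ⟧ * ⟦ suc k ⟧ ≢ 0ℚ
  D₁≢0 = *-≢0 (⟦suc⟧≢0 (suc k)) (⟦suc⟧≢0 k)
  lower-end : ∀ j → certificateF x k j ≐ sq (binom ⟦ suc (suc k) ⟧ j * binom (x + ⟦ j ⟧) k)
                                          · sq (⟦ j ⟧ * (x + ⟦ j ⟧ - ⟦ k ⟧)) * weightF ⟦ k ⟧ ⟦ j ⟧ x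
                                          ÷ sq (⟦ suc (suc k) ⟧ * ⟦ suc k ⟧)
  lower-end zero    = scaled (vanishes (sq (⟦ suc (suc k) ⟧ * ⟦ suc k ⟧)) (sq (binom ⟦ suc (suc k) ⟧ 0 * binom (x + ⟦ 0 ⟧) k))
                                       (x + ⟦ 0 ⟧ - ⟦ k ⟧) (weightF ⟦ k ⟧ ⟦ 0 ⟧ x))
    where vanishes : ∀ D β y q → 0ℚ * D ≡ β * ((0ℚ * y) * (0ℚ * y) * q)
          vanishes = solve-∀ ℚ-ring
  lower-end (suc i) = scaled-weight (weightF ⟦ k ⟧ ⟦ suc i ⟧ x)
    (scaled-sq (scaled-* (binom-absorbℕ (suc k) i) (binom-suc (x + ⟦ suc i ⟧) k)))

-- The sum  Σⱼ (k choose j) (k+j choose j) (x choose j) (x+j choose j)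

binom-pair : ℚ → ℕ → ℚ
binom-pair x j = binom x j * binom (x + ⟦ j ⟧) j

binom-pair-suc : ∀ x j → binom-pair x (suc j) * sq ⟦ suc j ⟧ ≡ binom-pair x j * ((x - ⟦ j ⟧) * (x + ⟦ suc j ⟧))
binom-pair-suc x j = unscale (scaled-* (binom-suc x j) (binom-absorb-shift x j j))

summandH : ℚ → ℕ → ℕ → ℚ
summandH x k j = binom ⟦ k ⟧ j * binom ⟦ k ℕ.+ j ⟧ j * binom-pair x j

certificateH : ℚ → ℕ → ℕ → ℚ
certificateH x k zero    = 0ℚ
certificateH x k (suc j) =
  binom ⟦ suc k ⟧ j * binom ⟦ suc k ℕ.+ j ⟧ j * (binom-pair x (suc j) * sq ⟦ suc j ⟧) * - (2 * (2 * ⟦ k ⟧ + 3))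

identityH : ∀ K K₁ K₂ J J₁ KJ₁ KJ₂ x → K₁ ≡ K + 1 → K₂ ≡ K + 2 → J₁ ≡ J + 1 → KJ₁ ≡ K + J + 1 → KJ₂ ≡ K + J + 2 →
  let c = - (2 * (2 * K + 3)) in
  (K + 1) * (K + 1) * (K + 1) * ((K₁ - J) * (K₂ - J))
  + - ((2 * K + 3) * (K * K + 3 * K + 3 + 2 * x * (x + 1))) * ((K₂ - J) * KJ₁)
  + (K + 2) * (K + 2) * (K + 2) * (KJ₂ * KJ₁)
  ≡ ((K₂ - J) * KJ₁) * ((x - J) * (x + J₁)) * c - (J * J) * (J * J) * c
identityH K .(K + 1) .(K + 2) J .(J + 1) .(K + J + 1) .(K + J + 2) x refl refl refl refl refl = solve (K ∷ J ∷ x ∷ []) ℚ-ring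

certificateH-telescopes : ∀ x k j →
  rec₀ k * summandH x k j + rec₁ x k * summandH x (suc k) j + rec₂ k * summandH x (suc (suc k)) j
  ≡ certificateH x k (suc j) - certificateH x k j
certificateH-telescopes x k j =
  certificate-scaled (rec₀ k) (rec₁ x k) (rec₂ k) (*-≢0 (⟦suc⟧≢0 (suc k)) (⟦suc⟧≢0 k))
    (scaled-*ʳ (binom-pair x j) (scaled-*ʳ (binom ⟦ k ℕ.+ j ⟧ j) (binom-upper-suc² k j)))
    (scaled-*ʳ (binom-pair x j) (scaled-* (binom-upper-sucℕ (suc k) j) (binom-upper-shift k j)))
    (scaled-*ʳ (binom-pair x j) (scaled-*ˡ (binom ⟦ suc (suc k) ⟧ j)
      (scaled-trans (binom-upper-shift (suc k) j) (binom-upper-shift k j))))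
    (lower-end j)
    (scaled-weight c (scaled-*-exact (scaled-* (binom-upper-sucℕ (suc k) j) (binom-upper-shift k j)) (binom-pair-suc x j)))
    (identityH ⟦ k ⟧ ⟦ suc k ⟧ ⟦ suc (suc k) ⟧ ⟦ j ⟧ ⟦ suc j ⟧ ⟦ suc (k ℕ.+ j) ⟧ ⟦ suc (suc (k ℕ.+ j)) ⟧ x
               (⟦suc⟧ k) (⟦2+⟧ k) (⟦suc⟧ j)
               (trans (⟦suc⟧ (k ℕ.+ j)) (cong (_+ 1) (⟦+⟧ k j))) (trans (⟦2+⟧ (k ℕ.+ j)) (cong (_+ 2) (⟦+⟧ k j))))
  where
  c : ℚ
  c = - (2 * (2 * ⟦ k ⟧ + 3))
  lower-end : ∀ j → certificateH x k j ≐ binom ⟦ suc (suc k) ⟧ j * binom ⟦ k ℕ.+ j ⟧ j * binom-pair x j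
                                          · (⟦ j ⟧ * ⟦ j ⟧) * sq ⟦ j ⟧ * c
                                          ÷ ⟦ suc (suc k) ⟧ * ⟦ suc k ⟧
  lower-end zero    = scaled (vanishes (⟦ suc (suc k) ⟧ * ⟦ suc k ⟧) (binom ⟦ suc (suc k) ⟧ 0 * binom ⟦ k ℕ.+ 0 ⟧ 0 * binom-pair x 0) c)
    where vanishes : ∀ D β c → 0ℚ * D ≡ β * ((0ℚ * 0ℚ) * (0ℚ * 0ℚ) * c)
          vanishes = solve-∀ ℚ-ring
  lower-end (suc i) = scaled-weight c (scaled-*-exact (scaled-* (binom-absorbℕ (suc k) i) (binom-lower-shift k i)) refl)

*-zeroˡ-≡ : ∀ {a} b → a ≡ 0ℚ → a * b ≡ 0ℚ
*-zeroˡ-≡ b refl = ℚP.*-zeroˡ b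

sumF sumH : ℚ → ℕ → ℚ
sumF x k = sumUpTo k (summandF x k)
sumH x k = sumUpTo k (summandH x k)

sumF-recurrence : ∀ x → SolvesRecurrence rec₀ (rec₁ x) rec₂ (sumF x)
sumF-recurrence x k =
  creative-telescoping k (rec₀ k) (rec₁ x k) (rec₂ k) _ _ _ (certificateF x k) (certificateF-telescopes x k)
    (λ j k<j → vanishes (binom-vanish k<j)) (λ j k+1<j → vanishes (binom-vanish k+1<j)) refl
    (*-zeroˡ-≡ _ (vanishes (binom-vanish (ℕP.n<1+n (suc k)))))
  where
  vanishes : ∀ {a b} → a ≡ 0ℚ → sq (a * b) ≡ 0ℚ
  vanishes {a} {b} a≡0 = *-zeroˡ-≡ (a * b) (*-zeroˡ-≡ b a≡0)

sumH-recurrence : ∀ x → SolvesRecurrence rec₀ (rec₁ x) rec₂ (sumH x)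
sumH-recurrence x k =
  creative-telescoping k (rec₀ k) (rec₁ x k) (rec₂ k) _ _ _ (certificateH x k) (certificateH-telescopes x k)
    (λ j k<j → vanishes (binom-vanish k<j)) (λ j k+1<j → vanishes (binom-vanish k+1<j)) refl
    (*-zeroˡ-≡ _ (vanishes (binom-vanish (ℕP.n<1+n (suc k)))))
  where
  vanishes : ∀ {a b c} → a ≡ 0ℚ → a * b * c ≡ 0ℚ
  vanishes {a} {b} {c} a≡0 = *-zeroˡ-≡ c (*-zeroˡ-≡ b a≡0)

sumF≡sumH : ∀ x k → sumF x k ≡ sumH x k
sumF≡sumH x = recurrence-unique {rec₀} {rec₁ x} {rec₂} rec₂≢0 (sumF-recurrence x) (sumH-recurrence x) refl initial
  where
  initial : sumF x 1 ≡ sumH x 1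
  initial = begin
    sq (1ℚ * binom (x + 0ℚ) 1) + sq (1ℚ * binom (x + 1ℚ) 1)
      ≡⟨ cong₂ (λ a b → sq (1ℚ * a) + sq (1ℚ * b)) (binom-1 (x + 0ℚ)) (binom-1 (x + 1ℚ)) ⟩
    sq (1ℚ * (x + 0ℚ)) + sq (1ℚ * (x + 1ℚ))
      ≡⟨ expand x ⟩
    1ℚ * 1ℚ * (1ℚ * 1ℚ) + 1ℚ * 2 * (x * (x + 1ℚ))
      ≡⟨ cong₂ (λ a b → 1ℚ * 1ℚ * (1ℚ * 1ℚ) + 1ℚ * 2 * (a * b)) (binom-1 x) (binom-1 (x + 1ℚ)) ⟨
    1ℚ * 1ℚ * (1ℚ * 1ℚ) + 1ℚ * 2 * (binom x 1 * binom (x + 1ℚ) 1) ∎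
    where
    open ≡-Reasoning
    expand : ∀ x → (1ℚ * (x + 0ℚ)) * (1ℚ * (x + 0ℚ)) + (1ℚ * (x + 1ℚ)) * (1ℚ * (x + 1ℚ))
                 ≡ 1ℚ * 1ℚ * (1ℚ * 1ℚ) + 1ℚ * 2 * (x * (x + 1ℚ))
    expand = solve-∀ ℚ-ring

-- Summation over k

catalan : ℕ → ℚ
catalan j = binom ⟦ j ℕ.+ j ⟧ j - binom ⟦ j ℕ.+ j ⟧ (suc j)

pair-quotient : ℚ → ℕ → ℚ
pair-quotient x j = catalan j * binom (x + ⟦ j ⟧) (j ℕ.+ j)

central-binom≡catalan : ∀ j → binom ⟦ j ℕ.+ j ⟧ j ≡ catalan j * ⟦ suc j ⟧
central-binom≡catalan j = begin
  c                                   ≡⟨ split c ⟦ j ⟧ ⟩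
  c * (⟦ j ⟧ + 1) - c * ⟦ j ⟧         ≡⟨ cong (λ t → c * (⟦ j ⟧ + 1) - t) c*j≡c′*[j+1] ⟩
  c * (⟦ j ⟧ + 1) - c′ * (⟦ j ⟧ + 1)  ≡⟨ factor c c′ (⟦ j ⟧ + 1) ⟩
  (c - c′) * (⟦ j ⟧ + 1)              ≡⟨ cong ((c - c′) *_) (⟦suc⟧ j) ⟨
  catalan j * ⟦ suc j ⟧               ∎
  where
  open ≡-Reasoning
  c c′ : ℚ
  c  = binom ⟦ j ℕ.+ j ⟧ j
  c′ = binom ⟦ j ℕ.+ j ⟧ (suc j)
  split : ∀ c j → c ≡ c * (j + 1) - c * j
  split = solve-∀ ℚ-ring
  factor : ∀ a b c → a * c - b * c ≡ (a - b) * c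
  factor = solve-∀ ℚ-ring
  c*j≡c′*[j+1] : c * ⟦ j ⟧ ≡ c′ * (⟦ j ⟧ + 1)
  c*j≡c′*[j+1] = begin
    c * ⟦ j ⟧                    ≡⟨ cong (c *_) (cancel ⟦ j ⟧) ⟨
    c * (⟦ j ⟧ + ⟦ j ⟧ - ⟦ j ⟧)  ≡⟨ cong (λ t → c * (t - ⟦ j ⟧)) (⟦+⟧ j j) ⟨
    c * (⟦ j ℕ.+ j ⟧ - ⟦ j ⟧)    ≡⟨ unscale (binom-suc ⟦ j ℕ.+ j ⟧ j) ⟨
    c′ * ⟦ suc j ⟧               ≡⟨ cong (c′ *_) (⟦suc⟧ j) ⟩
    c′ * (⟦ j ⟧ + 1)             ∎
    where cancel : ∀ a → a + a - a ≡ a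
          cancel = solve-∀ ℚ-ring

binom-pair≡pair-quotient : ∀ x j → binom-pair x j ≡ pair-quotient x j * ⟦ suc j ⟧
binom-pair≡pair-quotient x j = begin
  binom x j * binom (x + ⟦ j ⟧) j                          ≡⟨ ℚP.*-comm (binom x j) _ ⟩
  binom (x + ⟦ j ⟧) j * binom x j                          ≡⟨ binom-trinomial x j j ⟩
  binom ⟦ j ℕ.+ j ⟧ j * binom (x + ⟦ j ⟧) (j ℕ.+ j)        ≡⟨ cong (_* binom (x + ⟦ j ⟧) (j ℕ.+ j)) (central-binom≡catalan j) ⟩
  catalan j * ⟦ suc j ⟧ * binom (x + ⟦ j ⟧) (j ℕ.+ j)      ≡⟨ xy∙z≈xz∙y (catalan j) ⟦ suc j ⟧ _ ⟩
  pair-quotient x j * ⟦ suc j ⟧                            ∎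
  where open ≡-Reasoning

summandT : ℚ → ℕ → ℕ → ℚ
summandT x m j = pair-quotient x j * binom ⟦ m ⟧ j * binom ⟦ suc m ℕ.+ j ⟧ j

sumT : ℚ → ℕ → ℚ
sumT x m = sumUpTo m (summandT x m)

⟦odd⟧ : ∀ m → ⟦ 2 ℕ.* suc m ℕ.+ 1 ⟧ ≡ 2 * ⟦ m ⟧ + 3
⟦odd⟧ m = begin
  ⟦ 2 ℕ.* suc m ℕ.+ 1 ⟧    ≡⟨ ⟦+⟧ (2 ℕ.* suc m) 1 ⟩
  ⟦ 2 ℕ.* suc m ⟧ + 1      ≡⟨ cong (_+ 1) (⟦*⟧ 2 (suc m)) ⟩
  2 * ⟦ suc m ⟧ + 1        ≡⟨ cong (λ t → 2 * t + 1) (⟦suc⟧ m) ⟩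
  2 * (⟦ m ⟧ + 1) + 1      ≡⟨ simplify ⟦ m ⟧ ⟩
  2 * ⟦ m ⟧ + 3            ∎
  where
  open ≡-Reasoning
  simplify : ∀ m → 2 * (m + 1) + 1 ≡ 2 * m + 3
  simplify = solve-∀ ℚ-ring

summandT-step : ∀ x m j → sq ⟦ suc (suc m) ⟧ * summandT x (suc m) j
                          ≡ sq ⟦ suc m ⟧ * summandT x m j + ⟦ 2 ℕ.* suc m ℕ.+ 1 ⟧ * summandH x (suc m) j
summandT-step x m j = begin
  sq M₂ * (B * c₁ * g₂)                          ≡⟨ regroup M₂ B c₁ g₂ ⟩
  M₂ * B * c₁ * (g₂ * M₂)                        ≡⟨ cong (M₂ * B * c₁ *_) (unscale (binom-upper-shift (suc m) j)) ⟩
  M₂ * B * c₁ * (g₁ * MJ₂)                       ≡⟨ identity ⟦ m ⟧ M₁ M₂ ⟦ j ⟧ J₁ MJ₂ K B c₁ g₁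
                                                     (⟦suc⟧ m) (⟦2+⟧ m) (⟦suc⟧ j) (trans (⟦2+⟧ (m ℕ.+ j)) (cong (_+ 2) (⟦+⟧ m j))) (⟦odd⟧ m) ⟩
  M₁ * B * g₁ * (c₁ * (M₁ - ⟦ j ⟧)) + K * (c₁ * g₁ * (B * J₁))
    ≡⟨ cong₂ (λ s t → M₁ * B * g₁ * s + K * (c₁ * g₁ * t)) (unscale (binom-upper-sucℕ m j)) (binom-pair≡pair-quotient x j) ⟨
  M₁ * B * g₁ * (c₀ * M₁) + K * (c₁ * g₁ * binom-pair x j)
    ≡⟨ cong (_+ K * (c₁ * g₁ * binom-pair x j)) (regroup′ M₁ B g₁ c₀) ⟩
  sq M₁ * (B * c₀ * g₁) + K * (c₁ * g₁ * binom-pair x j) ∎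
  where
  open ≡-Reasoning
  M₁ M₂ J₁ MJ₂ K B c₀ c₁ g₁ g₂ : ℚ
  M₁ = ⟦ suc m ⟧
  M₂ = ⟦ suc (suc m) ⟧
  J₁ = ⟦ suc j ⟧
  MJ₂ = ⟦ suc (suc (m ℕ.+ j)) ⟧
  K = ⟦ 2 ℕ.* suc m ℕ.+ 1 ⟧
  B = pair-quotient x j
  c₀ = binom ⟦ m ⟧ j
  c₁ = binom ⟦ suc m ⟧ j
  g₁ = binom ⟦ suc (m ℕ.+ j) ⟧ j
  g₂ = binom ⟦ suc (suc (m ℕ.+ j)) ⟧ j
  regroup : ∀ M B c g → (M * M) * (B * c * g) ≡ M * B * c * (g * M)
  regroup = solve-∀ ℚ-ring
  regroup′ : ∀ M B g c → M * B * g * (c * M) ≡ (M * M) * (B * c * g)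
  regroup′ = solve-∀ ℚ-ring
  identity : ∀ M M₁ M₂ J J₁ MJ₂ K B c g → M₁ ≡ M + 1 → M₂ ≡ M + 2 → J₁ ≡ J + 1 → MJ₂ ≡ M + J + 2 → K ≡ 2 * M + 3 →
             M₂ * B * c * (g * MJ₂) ≡ M₁ * B * g * (c * (M₁ - J)) + K * (c * g * (B * J₁))
  identity M .(M + 1) .(M + 2) J .(J + 1) .(M + J + 2) .(2 * M + 3) B c g refl refl refl refl refl =
    solve (M ∷ J ∷ B ∷ c ∷ g ∷ []) ℚ-ring

weighted-sumH : ∀ x m → sumBelow (suc m) (λ k → ⟦ 2 ℕ.* k ℕ.+ 1 ⟧ * sumH x k) ≡ sq ⟦ suc m ⟧ * sumT x m
weighted-sumH x zero    = refl
weighted-sumH x (suc m) = begin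
  sumBelow (suc m) w + K * sumH x (suc m)
    ≡⟨ cong (_+ K * sumH x (suc m)) (weighted-sumH x m) ⟩
  sq ⟦ suc m ⟧ * sumT x m + K * sumH x (suc m)
    ≡⟨ cong (λ s → sq ⟦ suc m ⟧ * s + K * sumH x (suc m)) (sumUpTo-suc-vanish m (summandT x m) summandT-vanishes) ⟨
  sq ⟦ suc m ⟧ * Σ (summandT x m) + K * Σ (summandH x (suc m))
    ≡⟨ cong₂ _+_ (sumUpTo-*ˡ (suc m) (sq ⟦ suc m ⟧) (summandT x m)) (sumUpTo-*ˡ (suc m) K (summandH x (suc m))) ⟨
  Σ (λ j → sq ⟦ suc m ⟧ * summandT x m j) + Σ (λ j → K * summandH x (suc m) j)
    ≡⟨ sumUpTo-+ (suc m) (λ j → sq ⟦ suc m ⟧ * summandT x m j) (λ j → K * summandH x (suc m) j) ⟨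
  Σ (λ j → sq ⟦ suc m ⟧ * summandT x m j + K * summandH x (suc m) j)
    ≡⟨ sumUpTo-cong (suc m) (λ j _ → summandT-step x m j) ⟨
  Σ (λ j → sq ⟦ suc (suc m) ⟧ * summandT x (suc m) j)
    ≡⟨ sumUpTo-*ˡ (suc m) (sq ⟦ suc (suc m) ⟧) (summandT x (suc m)) ⟩
  sq ⟦ suc (suc m) ⟧ * sumT x (suc m) ∎
  where
  open ≡-Reasoning
  w : ℕ → ℚ
  w k = ⟦ 2 ℕ.* k ℕ.+ 1 ⟧ * sumH x k
  K : ℚ
  K = ⟦ 2 ℕ.* suc m ℕ.+ 1 ⟧
  Σ : (ℕ → ℚ) → ℚ
  Σ = sumUpTo (suc m)
  summandT-vanishes : summandT x m (suc m) ≡ 0ℚ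
  summandT-vanishes = trans (cong (λ t → pair-quotient x (suc m) * t * binom ⟦ suc m ℕ.+ suc m ⟧ (suc m)) (binom-vanish (ℕP.n<1+n m)))
                            (*-zeroˡ-≡ _ (ℚP.*-zeroʳ (pair-quotient x (suc m))))

-- Integrality

IsInteger : ℚ → Set
IsInteger q = ∃ λ z → q ≡ ℤ→ℚ z

IsInteger-+ : ∀ {p q} → IsInteger p → IsInteger q → IsInteger (p + q)
IsInteger-+ (z , p≡z) (w , q≡w) = z ℤ.+ w , trans (cong₂ _+_ p≡z q≡w) (sym (ℤ→ℚ-+ z w))

IsInteger-* : ∀ {p q} → IsInteger p → IsInteger q → IsInteger (p * q)
IsInteger-* (z , p≡z) (w , q≡w) = z ℤ.* w , trans (cong₂ _*_ p≡z q≡w) (sym (ℤ→ℚ-* z w))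

IsInteger-- : ∀ {p q} → IsInteger p → IsInteger q → IsInteger (p - q)
IsInteger-- {p} {q} isP (w , q≡w) =
  IsInteger-+ isP (ℤ.- w , trans (cong -_ q≡w) (sym (ℤ→ℚ-neg w)))

IsInteger-sumUpTo : ∀ n {f : ℕ → ℚ} → (∀ j → IsInteger (f j)) → IsInteger (sumUpTo n f)
IsInteger-sumUpTo zero    isF = isF 0
IsInteger-sumUpTo (suc n) isF = IsInteger-+ (IsInteger-sumUpTo n isF) (isF (suc n))

ℤ-induction : ∀ (P : ℤ → Set) → P (ℤ.+ 0) → (∀ z → P z → P (ℤ.suc z)) → (∀ z → P (ℤ.suc z) → P z) → ∀ z → P z
ℤ-induction P base up down (ℤ.+ zero)    = base
ℤ-induction P base up down (ℤ.+ suc n)   = up (ℤ.+ n) (ℤ-induction P base up down (ℤ.+ n))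
ℤ-induction P base up down -[1+ zero ]  = down -[1+ 0 ] base
ℤ-induction P base up down -[1+ suc n ] = down -[1+ suc n ] (ℤ-induction P base up down -[1+ n ])

ℤ→ℚ-suc : ∀ z → ℤ→ℚ (ℤ.suc z) ≡ ℤ→ℚ z + 1
ℤ→ℚ-suc z = trans (ℤ→ℚ-+ (ℤ.+ 1) z) (ℚP.+-comm 1 (ℤ→ℚ z))

binom-integer : ∀ m z → IsInteger (binom (ℤ→ℚ z) m)
binom-integer zero    z = ℤ.+ 1 , refl
binom-integer (suc m)   = ℤ-induction (λ z → IsInteger (binom (ℤ→ℚ z) (suc m)))
  (ℤ.+ 0 , binom-vanish {0} {suc m} (s≤s ℕ.z≤n))
  (λ z isInt → subst IsInteger (sym (pascal′ z)) (IsInteger-+ isInt (binom-integer m z)))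
  (λ z isInt → subst IsInteger (pascal⁻ z) (IsInteger-- isInt (binom-integer m z)))
  where
  pascal′ : ∀ z → binom (ℤ→ℚ (ℤ.suc z)) (suc m) ≡ binom (ℤ→ℚ z) (suc m) + binom (ℤ→ℚ z) m
  pascal′ z = trans (cong (λ y → binom y (suc m)) (ℤ→ℚ-suc z)) (pascal (ℤ→ℚ z) m)
  pascal⁻ : ∀ z → binom (ℤ→ℚ (ℤ.suc z)) (suc m) - binom (ℤ→ℚ z) m ≡ binom (ℤ→ℚ z) (suc m)
  pascal⁻ z = trans (cong (_- binom (ℤ→ℚ z) m) (pascal′ z)) (cancel (binom (ℤ→ℚ z) (suc m)) (binom (ℤ→ℚ z) m))
    where cancel : ∀ a b → a + b - b ≡ a
          cancel = solve-∀ ℚ-ring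

binomℕ-integer : ∀ n m → IsInteger (binom ⟦ n ⟧ m)
binomℕ-integer n m = binom-integer m (ℤ.+ n)

sumT-integer : ∀ z m → IsInteger (sumT (ℤ→ℚ z) m)
sumT-integer z m = IsInteger-sumUpTo m λ j →
  IsInteger-* (IsInteger-* (IsInteger-* (catalan-integer j) (upper-integer j)) (binomℕ-integer m j)) (binomℕ-integer (suc m ℕ.+ j) j)
  where
  catalan-integer : ∀ j → IsInteger (catalan j)
  catalan-integer j = IsInteger-- (binomℕ-integer (j ℕ.+ j) j) (binomℕ-integer (j ℕ.+ j) (suc j))
  upper-integer : ∀ j → IsInteger (binom (ℤ→ℚ z + ⟦ j ⟧) (j ℕ.+ j))
  upper-integer j = subst (λ y → IsInteger (binom y (j ℕ.+ j))) (ℤ→ℚ-+ z (ℤ.+ j)) (binom-integer (j ℕ.+ j) (z ℤ.+ ℤ.+ j))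

summand-reindex : ∀ x k j → j ℕ.≤ k → sq (binom (- x - 1ℚ) j) * sq (binom x (k ℕ.∸ j)) ≡ summandF x k j
summand-reindex x k j j≤k = begin
  sq (binom (- x - 1ℚ) j) * sq (binom x (k ℕ.∸ j))             ≡⟨ cong (_* sq (binom x (k ℕ.∸ j))) (sq-binom-neg x j) ⟩
  sq (binom (x + ⟦ j ⟧) j) * sq (binom x (k ℕ.∸ j))            ≡⟨ sq-* (binom (x + ⟦ j ⟧) j) _ ⟨
  sq (binom (x + ⟦ j ⟧) j * binom x (k ℕ.∸ j))                 ≡⟨ cong sq (binom-trinomial x j (k ℕ.∸ j)) ⟩
  sq (binom ⟦ k ℕ.∸ j ℕ.+ j ⟧ j * binom (x + ⟦ j ⟧) (k ℕ.∸ j ℕ.+ j))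
    ≡⟨ cong (λ n → sq (binom ⟦ n ⟧ j * binom (x + ⟦ j ⟧) n)) (ℕP.m∸n+n≡m j≤k) ⟩
  summandF x k j                                               ∎
  where open ≡-Reasoning

P≡sumT : ∀ m x → P (suc m) x ≡ sumT x m
P≡sumT m x = begin
  r * sumBelow (suc m) (λ k → ⟦ 2 ℕ.* k ℕ.+ 1 ⟧ * sumUpTo k (λ j → sq (binom (- x - 1ℚ) j) * sq (binom x (k ℕ.∸ j))))
    ≡⟨ cong (r *_) (sumBelow-cong (suc m) λ k → cong (⟦ 2 ℕ.* k ℕ.+ 1 ⟧ *_) (inner k)) ⟩
  r * sumBelow (suc m) (λ k → ⟦ 2 ℕ.* k ℕ.+ 1 ⟧ * sumH x k)
    ≡⟨ cong (r *_) (weighted-sumH x m) ⟩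
  r * (sq ⟦ suc m ⟧ * sumT x m)
    ≡⟨ cong (λ s → r * (s * sumT x m)) (⟦*⟧ (suc m) (suc m)) ⟨
  r * (⟦ suc m ℕ.* suc m ⟧ * sumT x m)
    ≡⟨ ℚP.*-assoc r ⟦ suc m ℕ.* suc m ⟧ (sumT x m) ⟨
  r * ⟦ suc m ℕ.* suc m ⟧ * sumT x m
    ≡⟨ cong (_* sumT x m) (recip-inverse (suc m ℕ.* suc m)) ⟩
  1ℚ * sumT x m
    ≡⟨ ℚP.*-identityˡ (sumT x m) ⟩
  sumT x m ∎
  where
  open ≡-Reasoning
  r : ℚ
  r = (ℤ.+ 1 / (suc m ℕ.* suc m)) {{ℕP.m*n≢0 (suc m) (suc m)}}
  inner : ∀ k → sumUpTo k (λ j → sq (binom (- x - 1ℚ) j) * sq (binom x (k ℕ.∸ j))) ≡ sumH x k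
  inner k = trans (sumUpTo-cong k (summand-reindex x k)) (sumF≡sumH x k)

theorem1p3 : (n : ℕ) → .{{_ : NonZero n}} → (x : ℤ) →
    ∃ (λ (m : ℤ) → P n (ℤ→ℚ x) ≡ ℤ→ℚ m)
theorem1p3 (suc m) x = proj₁ sumT-int , trans (P≡sumT m (ℤ→ℚ x)) (proj₂ sumT-int)
  where
  sumT-int : IsInteger (sumT (ℤ→ℚ x) m)
  sumT-int = sumT-integer x m
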